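{- Let $a,b$ be positive integers. There exists at most one regular configuration in $\mathrm{CONF}(a,b)$.
   Context: For nonnegative integers $a,b$, $\mathrm{CONF}(a,b)$ denotes the set of necklaces, i.e. circular arrangements up to rotation, of $a$ red beads and $b$ black beads. For $\Delta\in\mathrm{CONF}(a,b)$ with $b>0$, label the black beads $B_0,\dots,B_{b-1}$ consecutively around the circle and let $x_i$ be the number of red beads between $B_i$ and $B_{i+1}$ (indices mod $b$). The sequence $\{x_0,\dots,x_{b-1}\}$ is a characteristic sequence of $\Delta$; it has sum $a$ and is determined by $\Delta$ up to cyclic shift. Two configurations are equal if and only if their characteristic sequences are cyclic shifts of each other. $\Delta$ is regular if its characteristic sequence satisfies $\frac{a}{b}k-1 < x_i+x_{i+1}+\dots+x_{i+k-1} < \frac{a}{b}k+1$ for all $0\le i\le b-1$ and $1\le k\le 1+\lfloor b/2\rfloor$, with indices mod $b$. -}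

module Defs where

open import Data.Nat using (ℕ; zero; suc; _+_; _*_; _<_; _≤_; NonZero)
open import Data.Nat.DivMod using (_/_; _%_)
open import Data.Fin using (Fin; toℕ; fromℕ<)
open import Data.Nat.DivMod using (m%n<n)
open import Data.Product using (Σ; _×_)
open import Relation.Binary.PropositionalEquality using (_≡_)

-- A characteristic sequence of a configuration with b black beads:
-- x i = number of red beads between B_i and B_{i+1}.
Seq : ℕ → Set
Seq b = Fin b → ℕ

_⊕_ : ∀ {b} .{{_ : NonZero b}} → Fin b → ℕ → Fin b
_⊕_ {b} i j = fromℕ< (m%n<n (toℕ i + j) b)

window : ∀ {b} .{{_ : NonZero b}} → Seq b → Fin b → ℕ → ℕ
window x i zero    = 0
window x i (suc k) = x (i ⊕ k) + window x i k

total : ∀ {b} .{{_ : NonZero b}} → Seq b → ℕ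
total {b} x = window x (fromℕ< (m%n<n 0 b)) b

IsCharSeq : (a b : ℕ) .{{_ : NonZero b}} → Seq b → Set
IsCharSeq a b x = total x ≡ a

-- cyclic shift: y is x shifted by s, i.e. they describe the same configuration
CyclicShift : ∀ {b} .{{_ : NonZero b}} → Seq b → Seq b → Set
CyclicShift {b} x y = Σ ℕ (λ s → (i : Fin b) → y i ≡ x (i ⊕ s))

-- Regularity:  (a/b) k - 1 < S < (a/b) k + 1, multiplied through by b > 0:
--   a k < b S + b   and   b S < a k + b,
-- for all 0 ≤ i ≤ b-1 and 1 ≤ k ≤ 1 + ⌊b/2⌋.
Regular : (a b : ℕ) .{{_ : NonZero b}} → Seq b → Set
Regular a b x = (i : Fin b) (k : ℕ) → 1 ≤ k → k ≤ 1 + b / 2 →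
  (a * k < b * window x i k + b) × (b * window x i k < a * k + b)

module Submission where

-- Extend a characteristic sequence x periodically to X : ℕ → ℕ and write
-- W n k = X n + … + X (n + k - 1) for its window sums.  The proof shows that a
-- regular sequence, read from a suitable starting bead s, has window sums that
-- are forced by a and b alone:
--   * upper bound: b · W s k < a k + b for every k ≤ b.  Regularity gives this
--     for k ≤ 1 + ⌊b/2⌋; a longer window is the complement of a short one,
--     whose lower bound turns into the required upper bound;
--   * lower bound: a k ≤ b · W s k for every k.  Choose s minimising the
--     height b · W 0 m - a m of the lattice path over one period; the height is
--     b-periodic, so s minimises it globally and every window from s rises.
-- Hence W s k is the ceiling of a k / b for all k ≤ b.  Two regular sequences
-- with the same a, b therefore have equal window sums from their balanced
-- starts, hence equal entries, so one is a cyclic shift of the other.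

open import Defs
open import Data.Nat
open import Data.Nat.Properties
open import Data.Nat.DivMod
open import Data.Nat.Tactic.RingSolver using (solve-∀)
open import Data.Fin using (Fin; toℕ; fromℕ<)
open import Data.Fin.Properties using (fromℕ<-cong; fromℕ<-toℕ; toℕ-fromℕ<; toℕ<n)
open import Data.List using (upTo)
open import Data.List.Relation.Unary.All as All using (All)
open import Data.List.Membership.Propositional.Properties using (∈-upTo⁺; ∈-upTo⁻)
open import Data.List.Extrema ≤-totalOrder using (argmin; argmin-all; f[argmin]≤f[xs])
open import Data.Product using (Σ; _×_; _,_; proj₁; proj₂)
open import Relation.Binary.PropositionalEquality
open import Relation.Nullary using (yes; no)

ceiling-unique : ∀ b n {P Q} → n ≤ b * P → b * P < n + b → n ≤ b * Q → b * Q < n + b →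
                 P ≡ Q
ceiling-unique b n n≤bP bP<n+b n≤bQ bQ<n+b =
  ≤-antisym (below bP<n+b n≤bQ) (below bQ<n+b n≤bP)
  where
  below : ∀ {P Q} → b * P < n + b → n ≤ b * Q → P ≤ Q
  below {P} {Q} bP<n+b n≤bQ = s≤s⁻¹ (*-cancelˡ-< b P (suc Q) (begin-strict
    b * P       <⟨ bP<n+b ⟩
    n + b       ≤⟨ +-monoˡ-≤ b n≤bQ ⟩
    b * Q + b   ≡⟨ +-comm (b * Q) b ⟩
    b + b * Q   ≡⟨ *-suc b Q ⟨
    b * suc Q   ∎))
    where open ≤-Reasoning

complement-upper : ∀ a b k m Wk Wm → k + m ≡ b → Wk + Wm ≡ a →
                   a * m < b * Wm + b → b * Wk < a * k + b
complement-upper a b k m Wk Wm k+m≡b Wk+Wm≡a am<bWm+b =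
  +-cancelʳ-< (a * m) (b * Wk) (a * k + b) (begin-strict
    b * Wk + a * m          <⟨ +-monoʳ-< (b * Wk) am<bWm+b ⟩
    b * Wk + (b * Wm + b)   ≡⟨ +-assoc (b * Wk) (b * Wm) b ⟨
    (b * Wk + b * Wm) + b   ≡⟨ cong (_+ b) split ⟩
    (a * k + a * m) + b     ≡⟨ +-assoc (a * k) (a * m) b ⟩
    a * k + (a * m + b)     ≡⟨ cong (a * k +_) (+-comm (a * m) b) ⟩
    a * k + (b + a * m)     ≡⟨ +-assoc (a * k) b (a * m) ⟨
    a * k + b + a * m       ∎)
  where
  open ≤-Reasoning
  split : b * Wk + b * Wm ≡ a * k + a * m
  split = begin-equality
    b * Wk + b * Wm   ≡⟨ *-distribˡ-+ b Wk Wm ⟨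
    b * (Wk + Wm)     ≡⟨ cong (b *_) Wk+Wm≡a ⟩
    b * a             ≡⟨ *-comm b a ⟩
    a * b             ≡⟨ cong (a *_) k+m≡b ⟨
    a * (k + m)       ≡⟨ *-distribˡ-+ a k m ⟩
    a * k + a * m     ∎

complement-short : ∀ b k → b / 2 ≤ k → b ∸ k ≤ 1 + b / 2
complement-short b k half≤k = begin
  b ∸ k           ≤⟨ ∸-monoʳ-≤ b half≤k ⟩
  b ∸ b / 2       ≤⟨ m≤n+o⇒m∸n≤o b (b / 2) b≤2half+1 ⟩
  1 + b / 2       ∎
  where
  open ≤-Reasoning
  b≤2half+1 : b ≤ b / 2 + (1 + b / 2)
  b≤2half+1 = begin
    b                      ≡⟨ m≡m%n+[m/n]*n b 2 ⟩
    b % 2 + b / 2 * 2      ≤⟨ +-monoˡ-≤ (b / 2 * 2) (s≤s⁻¹ (m%n<n b 2)) ⟩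
    1 + b / 2 * 2          ≡⟨ eq (b / 2) ⟩
    b / 2 + (1 + b / 2)    ∎
    where
    eq : ∀ h → 1 + h * 2 ≡ h + (1 + h)
    eq = solve-∀

exchange-≤ : ∀ a p q u v s m → u + s ≡ v + m → p + a * u ≤ q + a * v → p + a * m ≤ q + a * s
exchange-≤ a p q u v s m u+s≡v+m le = +-cancelʳ-≤ (a * (u + s)) (p + a * m) (q + a * s) (begin
  p + a * m + a * (u + s)     ≡⟨ regroup a p u s m ⟩
  (p + a * u) + (a * s + a * m) ≤⟨ +-monoˡ-≤ (a * s + a * m) le ⟩
  (q + a * v) + (a * s + a * m) ≡⟨ regroup′ a q v s m ⟨
  q + a * s + a * (v + m)     ≡⟨ cong (λ w → q + a * s + a * w) u+s≡v+m ⟨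
  q + a * s + a * (u + s)     ∎)
  where
  open ≤-Reasoning
  regroup : ∀ a p u s m → p + a * m + a * (u + s) ≡ (p + a * u) + (a * s + a * m)
  regroup = solve-∀
  regroup′ : ∀ a q v s m → q + a * s + a * (v + m) ≡ (q + a * v) + (a * s + a * m)
  regroup′ = solve-∀

windowSum : (ℕ → ℕ) → ℕ → ℕ → ℕ
windowSum f n zero    = 0
windowSum f n (suc k) = f (n + k) + windowSum f n k

windowSum-++ : ∀ f n k m → windowSum f n (k + m) ≡ windowSum f n k + windowSum f (n + k) m
windowSum-++ f n k zero = begin
  windowSum f n (k + 0)   ≡⟨ cong (windowSum f n) (+-identityʳ k) ⟩
  windowSum f n k         ≡⟨ +-identityʳ _ ⟨
  windowSum f n k + 0     ∎
  where open ≡-Reasoning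
windowSum-++ f n k (suc m) = begin
  windowSum f n (k + suc m)
    ≡⟨ cong (windowSum f n) (+-suc k m) ⟩
  f (n + (k + m)) + windowSum f n (k + m)
    ≡⟨ cong₂ _+_ (cong f (sym (+-assoc n k m))) (windowSum-++ f n k m) ⟩
  f (n + k + m) + (windowSum f n k + windowSum f (n + k) m)
    ≡⟨ +-comm-middle (f (n + k + m)) (windowSum f n k) (windowSum f (n + k) m) ⟩
  windowSum f n k + (f (n + k + m) + windowSum f (n + k) m)
    ∎
  where
  open ≡-Reasoning
  +-comm-middle : ∀ p q r → p + (q + r) ≡ q + (p + r)
  +-comm-middle = solve-∀

module _ {b : ℕ} .{{_ : NonZero b}} where

  Periodic : (ℕ → ℕ) → Set
  Periodic f = ∀ {m n} → m % b ≡ n % b → f m ≡ f n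

  %-cong-+ : ∀ {m n p q} → m % b ≡ n % b → p % b ≡ q % b → (m + p) % b ≡ (n + q) % b
  %-cong-+ {m} {n} {p} {q} m≡n p≡q = begin
    (m + p) % b             ≡⟨ %-distribˡ-+ m p b ⟩
    (m % b + p % b) % b     ≡⟨ cong₂ (λ u v → (u + v) % b) m≡n p≡q ⟩
    (n % b + q % b) % b     ≡⟨ %-distribˡ-+ n q b ⟨
    (n + q) % b             ∎
    where open ≡-Reasoning

  windowSum-periodic : ∀ {f} → Periodic f → ∀ {m n} k → m % b ≡ n % b →
                       windowSum f m k ≡ windowSum f n k
  windowSum-periodic per zero    m≡n = refl
  windowSum-periodic per (suc k) m≡n =
    cong₂ _+_ (per (%-cong-+ m≡n refl)) (windowSum-periodic per k m≡n)

  full-window : ∀ {f} → Periodic f → ∀ n → windowSum f n b ≡ windowSum f 0 b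
  full-window {f} per n = +-cancelˡ-≡ (windowSum f 0 n) _ _ (begin
    windowSum f 0 n + windowSum f n b   ≡⟨ windowSum-++ f 0 n b ⟨
    windowSum f 0 (n + b)               ≡⟨ cong (windowSum f 0) (+-comm n b) ⟩
    windowSum f 0 (b + n)               ≡⟨ windowSum-++ f 0 b n ⟩
    windowSum f 0 b + windowSum f b n   ≡⟨ cong (windowSum f 0 b +_) (windowSum-periodic per n b%b≡0%b) ⟩
    windowSum f 0 b + windowSum f 0 n   ≡⟨ +-comm (windowSum f 0 b) _ ⟩
    windowSum f 0 n + windowSum f 0 b   ∎)
    where
    open ≡-Reasoning
    b%b≡0%b : b % b ≡ 0 % b
    b%b≡0%b = [m+n]%n≡m%n 0 b

  periodic-translate : ∀ {f} → Periodic f → ∀ s → Periodic (λ k → f (s + k))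
  periodic-translate per s m≡n = per (%-cong-+ refl m≡n)

  periodic-ext : ∀ {f g} → Periodic f → Periodic g → (∀ k → k < b → f k ≡ g k) →
                 ∀ k → f k ≡ g k
  periodic-ext {f} {g} perf perg agree k = begin
    f k         ≡⟨ perf (m%n%n≡m%n k b) ⟨
    f (k % b)   ≡⟨ agree (k % b) (m%n<n k b) ⟩
    g (k % b)   ≡⟨ perg (m%n%n≡m%n k b) ⟩
    g k         ∎
    where open ≡-Reasoning

  extend : Seq b → ℕ → ℕ
  extend x n = x (fromℕ< (m%n<n n b))

  extend-periodic : ∀ x → Periodic (extend x)
  extend-periodic x {m} {n} m≡n = cong x (fromℕ<-cong (m % b) (n % b) m≡n _ _)

  extend-toℕ : ∀ x (i : Fin b) → extend x (toℕ i) ≡ x i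
  extend-toℕ x i = cong x (trans (fromℕ<-cong _ _ (m<n⇒m%n≡m (toℕ<n i)) _ (toℕ<n i))
                                  (fromℕ<-toℕ i _))

  window-extend : ∀ x i k → window x i k ≡ windowSum (extend x) (toℕ i) k
  window-extend x i zero    = refl
  window-extend x i (suc k) = cong (x (i ⊕ k) +_) (window-extend x i k)

  window-at : ∀ x n k → window x (fromℕ< (m%n<n n b)) k ≡ windowSum (extend x) n k
  window-at x n k = begin
    window x (fromℕ< (m%n<n n b)) k                        ≡⟨ window-extend x _ k ⟩
    windowSum (extend x) (toℕ (fromℕ< (m%n<n n b))) k      ≡⟨ windowSum-periodic (extend-periodic x) k residue ⟩
    windowSum (extend x) n k                               ∎
    where
    open ≡-Reasoning
    residue : toℕ (fromℕ< (m%n<n n b)) % b ≡ n % b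
    residue = trans (cong (_% b) (toℕ-fromℕ< (m%n<n n b))) (m%n%n≡m%n n b)

module RegularSequence {b : ℕ} .{{_ : NonZero b}} (a : ℕ) (x : Seq b)
                       (total≡a : IsCharSeq a b x) (regular : Regular a b x) where

  X : ℕ → ℕ
  X = extend x

  W : ℕ → ℕ → ℕ
  W = windowSum X

  period-sum : ∀ n → W n b ≡ a
  period-sum n = trans (full-window (extend-periodic x) n) (trans (sym (window-at x 0 b)) total≡a)

  regular-at : ∀ n k → k ≤ 1 + b / 2 → (a * k < b * W n k + b) × (b * W n k < a * k + b)
  regular-at n zero    _     rewrite *-zeroʳ a | *-zeroʳ b = >-nonZero⁻¹ b , >-nonZero⁻¹ b
  regular-at n (suc k) short =
    subst (λ w → (a * suc k < b * w + b) × (b * w < a * suc k + b)) (window-at x n (suc k))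
          (regular (fromℕ< (m%n<n n b)) (suc k) (s≤s z≤n) short)

  -- Upper regularity bound for every window within one period: long windows
  -- are complements of short ones.
  upper-bound : ∀ n k → k ≤ b → b * W n k < a * k + b
  upper-bound n k k≤b with k ≤? 1 + b / 2
  ... | yes short = proj₂ (regular-at n k short)
  ... | no  long  = complement-upper a b k m (W n k) (W (n + k) m) k+m≡b sums
                      (proj₁ (regular-at (n + k) m (complement-short b k half≤k)))
    where
    m : ℕ
    m = b ∸ k
    k+m≡b : k + m ≡ b
    k+m≡b = m+[n∸m]≡n k≤b
    sums : W n k + W (n + k) m ≡ a
    sums = trans (sym (windowSum-++ X n k m)) (trans (cong (W n) k+m≡b) (period-sum n))
    half≤k : b / 2 ≤ k
    half≤k = ≤-trans (m≤n+m (b / 2) 2) (≰⇒> long)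

  -- Height≤ s m: the lattice path, of height b · W 0 m - a · m after m steps,
  -- is at least as high at m as at s.
  Height≤ : ℕ → ℕ → Set
  Height≤ s m = b * W 0 s + a * m ≤ b * W 0 m + a * s

  rising-window : ∀ s k → Height≤ s (s + k) → a * k ≤ b * W s k
  rising-window s k low = +-cancelˡ-≤ (b * W 0 s + a * s) (a * k) (b * W s k) (begin
    b * W 0 s + a * s + a * k       ≡⟨ regroupˡ (b * W 0 s) a s k ⟩
    b * W 0 s + a * (s + k)         ≤⟨ low ⟩
    b * W 0 (s + k) + a * s         ≡⟨ cong (λ w → b * w + a * s) (windowSum-++ X 0 s k) ⟩
    b * (W 0 s + W s k) + a * s     ≡⟨ regroupʳ b (W 0 s) (W s k) (a * s) ⟩
    b * W 0 s + a * s + b * W s k   ∎)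
    where
    open ≤-Reasoning
    regroupˡ : ∀ p a s k → p + a * s + a * k ≡ p + a * (s + k)
    regroupˡ = solve-∀
    regroupʳ : ∀ b u v r → b * (u + v) + r ≡ b * u + r + b * v
    regroupʳ = solve-∀

  -- The height is b-periodic: one more period adds a red beads over b steps.
  height-periodic : ∀ s m → Height≤ s m → Height≤ s (m + b)
  height-periodic s m low = begin
    b * W 0 s + a * (m + b)       ≡⟨ regroupˡ (b * W 0 s) a m b ⟩
    b * W 0 s + a * m + a * b     ≤⟨ +-monoˡ-≤ (a * b) low ⟩
    b * W 0 m + a * s + a * b     ≡⟨ regroupʳ b (W 0 m) a (a * s) ⟩
    b * (W 0 m + a) + a * s       ≡⟨ cong (λ w → b * (W 0 m + w) + a * s) (period-sum m) ⟨
    b * (W 0 m + W m b) + a * s   ≡⟨ cong (λ w → b * w + a * s) (windowSum-++ X 0 m b) ⟨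
    b * W 0 (m + b) + a * s       ∎
    where
    open ≤-Reasoning
    regroupˡ : ∀ p a m b → p + a * (m + b) ≡ p + a * m + a * b
    regroupˡ = solve-∀
    regroupʳ : ∀ b u a r → b * u + r + a * b ≡ b * (u + a) + r
    regroupʳ = solve-∀

  height-global : ∀ s → (∀ m → m < b → Height≤ s m) → ∀ m → Height≤ s m
  height-global s lowest m = subst (Height≤ s) (sym (m≡m%n+[m/n]*n m b)) (periods (m / b))
    where
    periods : ∀ q → Height≤ s (m % b + q * b)
    periods zero    = subst (Height≤ s) (sym (+-identityʳ (m % b))) (lowest (m % b) (m%n<n m b))
    periods (suc q) = subst (Height≤ s) (trans (+-assoc (m % b) (q * b) b)
                                               (cong (m % b +_) (+-comm (q * b) b)))
                            (height-periodic s _ (periods q))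

  -- The height raised by a · b, which is a natural number on [0, b].
  potential : ℕ → ℕ
  potential m = b * W 0 m + a * (b ∸ m)

  potential-≤ : ∀ {s m} → s ≤ b → m ≤ b → potential s ≤ potential m → Height≤ s m
  potential-≤ {s} {m} s≤b m≤b =
    exchange-≤ a (b * W 0 s) (b * W 0 m) (b ∸ s) (b ∸ m) s m
               (trans (m∸n+n≡m s≤b) (sym (m∸n+n≡m m≤b)))

  balanced-start : Σ ℕ λ s → s < b × (∀ k → a * k ≤ b * W s k)
  balanced-start = s , s<b , λ k → rising-window s k (height-global s lowest (s + k))
    where
    s : ℕ
    s = argmin potential 0 (upTo b)
    s<b : s < b
    s<b = argmin-all potential {xs = upTo b} {P = _< b} (>-nonZero⁻¹ b) (All.tabulate ∈-upTo⁻)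
    lowest : ∀ m → m < b → Height≤ s m
    lowest m m<b = potential-≤ (<⇒≤ s<b) (<⇒≤ m<b)
      (All.lookup (f[argmin]≤f[xs] {f = potential} 0 (upTo b)) (∈-upTo⁺ m<b))

shift-from-windows : ∀ {b} .{{_ : NonZero b}} (x y : Seq b) s t → t < b →
  (∀ k → k ≤ b → windowSum (extend x) s k ≡ windowSum (extend y) t k) → CyclicShift x y
shift-from-windows {b} x y s t t<b windows = s + (b ∸ t) , shifted
  where
  open ≡-Reasoning
  -- consecutive windows differ by one entry
  entries : ∀ k → k < b → extend x (s + k) ≡ extend y (t + k)
  entries k k<b = +-cancelʳ-≡ (windowSum (extend x) s k) _ _ (begin
    windowSum (extend x) s (suc k)                        ≡⟨ windows (suc k) k<b ⟩
    windowSum (extend y) t (suc k)                        ≡⟨ cong (extend y (t + k) +_) (windows k (<⇒≤ k<b)) ⟨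
    extend y (t + k) + windowSum (extend x) s k           ∎)
  everywhere : ∀ k → extend x (s + k) ≡ extend y (t + k)
  everywhere = periodic-ext (periodic-translate (extend-periodic x) s)
                            (periodic-translate (extend-periodic y) t) entries
  wraps : ∀ i → t + ((b ∸ t) + i) ≡ i + b
  wraps i = trans (sym (+-assoc t (b ∸ t) i)) (trans (cong (_+ i) (m+[n∸m]≡n (<⇒≤ t<b))) (+-comm b i))
  shifted : (i : Fin b) → y i ≡ x (i ⊕ (s + (b ∸ t)))
  shifted i = begin
    y i                                   ≡⟨ extend-toℕ y i ⟨
    extend y (toℕ i)                      ≡⟨ extend-periodic y (trans (sym ([m+n]%n≡m%n (toℕ i) b))
                                                                      (cong (_% b) (sym (wraps (toℕ i))))) ⟩
    extend y (t + ((b ∸ t) + toℕ i))      ≡⟨ everywhere ((b ∸ t) + toℕ i) ⟨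
    extend x (s + ((b ∸ t) + toℕ i))      ≡⟨ cong (extend x) (rotate s (b ∸ t) (toℕ i)) ⟩
    extend x (toℕ i + (s + (b ∸ t)))      ∎
    where
    rotate : ∀ s r i → s + (r + i) ≡ i + (s + r)
    rotate = solve-∀

theorem2 : (a b : ℕ) → 0 < a → .{{_ : NonZero b}} → (x y : Seq b) →
    IsCharSeq a b x → Regular a b x →
    IsCharSeq a b y → Regular a b y →
    CyclicShift x y
theorem2 a b _ x y total-x regular-x total-y regular-y =
  shift-from-windows x y s t t<b same-windows
  where
  module RX = RegularSequence a x total-x regular-x
  module RY = RegularSequence a y total-y regular-y
  s t : ℕ
  s = proj₁ RX.balanced-start
  t = proj₁ RY.balanced-start
  t<b : t < b
  t<b = proj₁ (proj₂ RY.balanced-start)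
  -- from balanced starts, both window sums are the ceiling of a k / b
  same-windows : ∀ k → k ≤ b → RX.W s k ≡ RY.W t k
  same-windows k k≤b = ceiling-unique b (a * k)
    (proj₂ (proj₂ RX.balanced-start) k) (RX.upper-bound s k k≤b)
    (proj₂ (proj₂ RY.balanced-start) k) (RY.upper-bound t k k≤b)
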